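{- Let $\mathbb G$ be a graph of pathwidth $k\geq 1$. Then $\operatorname{Pos}(\mathbb G)$ has pathwidth at most $3k+7$ and $\operatorname{Pos}_\bot(\mathbb G)$ has pathwidth at most $3k+8$.
   Context: The pathwidth of a poset is the pathwidth of its cover graph (vertices are the elements; $x,y$ adjacent iff one covers the other). Construction: for a graph $\mathbb G=(V,E)$, $\operatorname{Pos}(\mathbb G)$ has carrier $V\cup V_a\cup V_b\cup E_1\cup E_2\cup\{\top_1,\top_2,\infty_a,\infty_b\}$, where $V_a=\{v_a\},V_b=\{v_b\}$ are disjoint copies of $V$, $E_1=\{e_1\},E_2=\{e_2\}$ are disjoint copies of $E$, and the last four elements are new; its order is the reflexive–transitive closure of the covering relation: $v\prec v_a$, $v\prec v_b$, $v_a\prec\infty_a$, $v_b\prec\infty_b$ ($v\in V$); $e_1,e_2\prec\top_1$ and $e_1,e_2\prec\top_2$ ($e\in E$); $v_a,v_b\prec\top_1,\top_2$ for isolated $v$; and for each edge $e=uv$, $u_a,v_b\prec e_i$ and $u_b,v_a\prec e_j$ with $\{i,j\}=\{1,2\}$ (choice of copy arbitrary). $\operatorname{Pos}_\bot(\mathbb G)$ is $\operatorname{Pos}(\mathbb G)$ with a new least element $\bot$ added. -}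

module Defs where

open import Data.Nat using (ℕ; suc; _≤_)
open import Data.Fin using (Fin) renaming (_<_ to _<ᶠ_; _≤_ to _≤ᶠ_)
open import Data.Bool using (Bool; true; false; T)
open import Data.List using (List; length)
open import Data.List.Membership.Propositional using (_∈_)
open import Data.List.Relation.Unary.Unique.Propositional using (Unique)
open import Data.Maybe using (Maybe; just; nothing)
open import Data.Product using (Σ; ∃; _×_; _,_)
open import Data.Sum using (_⊎_)
open import Relation.Nullary using (¬_)
open import Relation.Binary.PropositionalEquality using (_≡_)
open import Relation.Binary.Construct.Closure.ReflexiveTransitive using (Star)

record PathDecomposition (V : Set) (Adj : V → V → Set) : Set where
  field
    m       : ℕ
    bag     : Fin m → List V
    unique  : ∀ i → Unique (bag i)   -- bags are sets
    covers-vertex : ∀ v → ∃ λ i → v ∈ bag i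
    covers-edge   : ∀ u v → Adj u v → ∃ λ i → u ∈ bag i × v ∈ bag i
    contiguous    : ∀ v (i j l : Fin m) → i ≤ᶠ j → j ≤ᶠ l →
                    v ∈ bag i → v ∈ bag l → v ∈ bag j

open PathDecomposition public

WidthAtMost : ∀ {V Adj} → PathDecomposition V Adj → ℕ → Set
WidthAtMost D w = ∀ i → length (bag D i) ≤ suc w

PathwidthAtMost : (V : Set) → (V → V → Set) → ℕ → Set
PathwidthAtMost V Adj w = Σ (PathDecomposition V Adj) λ D → WidthAtMost D w

HasPathwidth : (V : Set) → (V → V → Set) → ℕ → Set
HasPathwidth V Adj k =
  PathwidthAtMost V Adj k × (∀ w → PathwidthAtMost V Adj w → k ≤ w)

Covers : {P : Set} → (P → P → Set) → P → P → Set
Covers _≤ₚ_ x y =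
  x ≤ₚ y × ¬ (x ≡ y) × (∀ z → x ≤ₚ z → z ≤ₚ y → z ≡ x ⊎ z ≡ y)

CoverAdj : {P : Set} → (P → P → Set) → P → P → Set
CoverAdj _≤ₚ_ x y = Covers _≤ₚ_ x y ⊎ Covers _≤ₚ_ y x

record Graph : Set where
  field
    n      : ℕ
    adj    : Fin n → Fin n → Bool
    sym    : ∀ u v → adj u v ≡ adj v u
    irrefl : ∀ v → adj v v ≡ false

open Graph public

Adj : (G : Graph) → Fin (n G) → Fin (n G) → Set
Adj G u v = T (adj G u v)

Edge : Graph → Set
Edge G = Σ (Fin (n G)) λ u → Σ (Fin (n G)) λ v → u <ᶠ v × T (adj G u v)

Isolated : (G : Graph) → Fin (n G) → Set
Isolated G v = ∀ u → adj G v u ≡ false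

-- An orientation σ : Edge G → Bool records the arbitrary choice:
-- for e = uv (u < v),  σ e = true  means  u_a, v_b ≺ e₁  and  u_b, v_a ≺ e₂,
--                      σ e = false means  u_a, v_b ≺ e₂  and  u_b, v_a ≺ e₁.

data PosEl (G : Graph) : Set where
  vtx va vb : Fin (n G) → PosEl G
  e₁ e₂     : Edge G → PosEl G
  ⊤₁ ⊤₂ ∞a ∞b : PosEl G

data Gen (G : Graph) (σ : Edge G → Bool) : PosEl G → PosEl G → Set where
  v-va  : ∀ v → Gen G σ (vtx v) (va v)
  v-vb  : ∀ v → Gen G σ (vtx v) (vb v)
  va-∞a : ∀ v → Gen G σ (va v) ∞a
  vb-∞b : ∀ v → Gen G σ (vb v) ∞b
  e₁-⊤₁ : ∀ e → Gen G σ (e₁ e) ⊤₁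
  e₁-⊤₂ : ∀ e → Gen G σ (e₁ e) ⊤₂
  e₂-⊤₁ : ∀ e → Gen G σ (e₂ e) ⊤₁
  e₂-⊤₂ : ∀ e → Gen G σ (e₂ e) ⊤₂
  iso-va-⊤₁ : ∀ v → Isolated G v → Gen G σ (va v) ⊤₁
  iso-va-⊤₂ : ∀ v → Isolated G v → Gen G σ (va v) ⊤₂
  iso-vb-⊤₁ : ∀ v → Isolated G v → Gen G σ (vb v) ⊤₁
  iso-vb-⊤₂ : ∀ v → Isolated G v → Gen G σ (vb v) ⊤₂
  t-ua-e₁ : ∀ u v p a → σ (u , v , p , a) ≡ true → Gen G σ (va u) (e₁ (u , v , p , a))
  t-vb-e₁ : ∀ u v p a → σ (u , v , p , a) ≡ true → Gen G σ (vb v) (e₁ (u , v , p , a))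
  t-ub-e₂ : ∀ u v p a → σ (u , v , p , a) ≡ true → Gen G σ (vb u) (e₂ (u , v , p , a))
  t-va-e₂ : ∀ u v p a → σ (u , v , p , a) ≡ true → Gen G σ (va v) (e₂ (u , v , p , a))
  f-ua-e₂ : ∀ u v p a → σ (u , v , p , a) ≡ false → Gen G σ (va u) (e₂ (u , v , p , a))
  f-vb-e₂ : ∀ u v p a → σ (u , v , p , a) ≡ false → Gen G σ (vb v) (e₂ (u , v , p , a))
  f-ub-e₁ : ∀ u v p a → σ (u , v , p , a) ≡ false → Gen G σ (vb u) (e₁ (u , v , p , a))
  f-va-e₁ : ∀ u v p a → σ (u , v , p , a) ≡ false → Gen G σ (va v) (e₁ (u , v , p , a))

PosOrder : (G : Graph) (σ : Edge G → Bool) → PosEl G → PosEl G → Set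
PosOrder G σ = Star (Gen G σ)

-- Pos_⊥(G): nothing = the new least element ⊥
data PosBotOrder (G : Graph) (σ : Edge G → Bool) : Maybe (PosEl G) → Maybe (PosEl G) → Set where
  bot≤  : ∀ x → PosBotOrder G σ nothing x
  lift≤ : ∀ {x y} → PosOrder G σ x y → PosBotOrder G σ (just x) (just y)

-- Start from a path decomposition of G of width k and assign every edge uv to a bag containing u
-- and v. Replace each bag X by several copies, all containing ⊤₁, ⊤₂, ∞a, ∞b
-- and v, v_a, v_b for v ∈ X, and add each copy e₁, e₂ of an edge assigned to X
-- to a copy of its own. Every cover pair then lies in a common bag, an element
-- of V ∪ V_a ∪ V_b occupies a run of consecutive bags because its vertex does
-- in the decomposition of G, and bags have at most 4 + 3(k + 1) + 1 = 3k + 8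
-- elements. For Pos_⊥(G), add ⊥ to every bag.

module Submission where

open import Defs hiding (sym)
open import Data.Nat as ℕ using (ℕ; suc; _≤_; _+_; _*_; s≤s; z≤n)
import Data.Nat.Properties as ℕ
open import Data.Nat.Solver using (module +-*-Solver)
open import Data.Bool using (Bool)
open import Data.Bool.Properties using (T-irrelevant)
open import Data.Fin as Fin using (Fin; zero; suc; combine; remQuot; quotient; remainder)
import Data.Fin.Properties as Fin
open import Data.Maybe using (Maybe; just; nothing)
open import Data.Maybe.Properties using (just-injective)
open import Data.Product using (_×_; _,_; proj₁; proj₂; ∃; uncurry; map₁; map₂; swap)
open import Data.Sum using (inj₁; inj₂)
import Data.Sum as Sum
open import Data.Empty using (⊥-elim)
open import Data.List using (List; []; _∷_; _++_; [_]; map; concatMap; length)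
open import Data.List.Properties using (length-++; length-map)
open import Data.List.Membership.Propositional using (_∈_; find; lose)
open import Data.List.Membership.Propositional.Properties
  using (∈-map⁺; ∈-map⁻; ∈-++⁺ˡ; ∈-++⁺ʳ; ∈-++⁻; ∈-concatMap⁺; ∈-concatMap⁻)
open import Data.List.Relation.Unary.Any using (here; there)
import Data.List.Relation.Unary.All as All
import Data.List.Relation.Unary.All.Properties as All
import Data.List.Relation.Unary.AllPairs as AllPairs
import Data.List.Relation.Unary.AllPairs.Properties as AllPairs
open import Data.List.Relation.Unary.AllPairs using ([]; _∷_)
open import Data.List.Relation.Unary.Unique.Propositional using (Unique)
import Data.List.Relation.Unary.Unique.Propositional.Properties as Unique
open import Data.List.Relation.Binary.Disjoint.Propositional using (Disjoint)
open import Function using (_∘_)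
open import Relation.Nullary using (¬_; yes; no)
open import Relation.Nullary.Decidable using (T?)
open import Relation.Binary.PropositionalEquality hiding ([_])
open import Relation.Binary.Construct.Closure.ReflexiveTransitive using (Star; ε; _◅_)

disjoint-by : {A B : Set} (f : A → B) {xs ys : List A} {b : B} →
              (∀ {x} → x ∈ xs → f x ≡ b) → (∀ {y} → y ∈ ys → f y ≢ b) → Disjoint xs ys
disjoint-by f xs≡b ys≢b (x∈xs , x∈ys) = ys≢b x∈ys (xs≡b x∈xs)

quotient-mono : ∀ {n} k {a b : Fin (n * k)} → a Fin.≤ b → quotient {n} k a Fin.≤ quotient {n} k b
quotient-mono {n} k {a} {b} a≤b = ℕ.≮⇒≥ λ qb<qa → ℕ.<⇒≱ (b<a qb<qa) a≤b
  where
  b<a : quotient {n} k b Fin.< quotient {n} k a → b Fin.< a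
  b<a q = subst₂ Fin._<_ (Fin.combine-remQuot {n} k b) (Fin.combine-remQuot {n} k a)
            (Fin.combine-monoˡ-< (proj₂ (remQuot {n} k b)) (proj₂ (remQuot {n} k a)) q)

Contiguous : {A : Set} {m : ℕ} → (Fin m → List A) → A → Set
Contiguous Z x = ∀ i j l → i Fin.≤ j → j Fin.≤ l → x ∈ Z i → x ∈ Z l → x ∈ Z j

module _ {A : Set} {m : ℕ} (Z : Fin m → List A) where

  contiguous-everywhere : ∀ {x} → (∀ t → x ∈ Z t) → Contiguous Z x
  contiguous-everywhere x∈Z _ j _ _ _ _ _ = x∈Z j

  contiguous-single : ∀ {x} t₀ → (∀ t → x ∈ Z t → t ≡ t₀) → Contiguous Z x
  contiguous-single t₀ only i j l i≤j j≤l x∈Zi x∈Zl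
    with refl ← only i x∈Zi | refl ← only l x∈Zl
    = subst (λ t → _ ∈ Z t) (Fin.≤-antisym i≤j j≤l) x∈Zi

  contiguous-pullback : ∀ {B : Set} {n} {W : Fin n → List B} {x y}
    (π : Fin m → Fin n) → (∀ {a b} → a Fin.≤ b → π a Fin.≤ π b) →
    (∀ t → x ∈ Z t → y ∈ W (π t)) → (∀ t → y ∈ W (π t) → x ∈ Z t) →
    Contiguous W y → Contiguous Z x
  contiguous-pullback π mono to from contiguousW i j l i≤j j≤l x∈Zi x∈Zl =
    from j (contiguousW (π i) (π j) (π l) (mono i≤j) (mono j≤l) (to i x∈Zi) (to l x∈Zl))

covers⇒step : ∀ {P : Set} {R : P → P → Set} → (∀ {x} → ¬ R x x) →
              ∀ {x y} → Covers (Star R) x y → R x y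
covers⇒step irrefl (ε , x≢x , _) = ⊥-elim (x≢x refl)
covers⇒step irrefl (_◅_ {j = z} x⟶z z⟶*y , _ , between) with between z (x⟶z ◅ ε) z⟶*y
... | inj₁ refl = ⊥-elim (irrefl x⟶z)
... | inj₂ refl = x⟶z

module _ {V : Set} {Adj : V → V → Set} (D : PathDecomposition V Adj) (i₀ : Fin (m D))
         {Adj′ : Maybe V → Maybe V → Set} (restrict : ∀ x y → Adj′ (just x) (just y) → Adj x y) where

  private
    apexBag : Fin (m D) → List (Maybe V)
    apexBag i = nothing ∷ map just (bag D i)

    just∈apexBag : ∀ {x i} → x ∈ bag D i → just x ∈ apexBag i
    just∈apexBag x∈X = there (∈-map⁺ just x∈X)

    just∈apexBag⁻ : ∀ {x i} → just x ∈ apexBag i → x ∈ bag D i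
    just∈apexBag⁻ (there x∈map) with ∈-map⁻ just x∈map
    ... | _ , x∈X , refl = x∈X

    apexBag-unique : ∀ i → Unique (apexBag i)
    apexBag-unique i = All.map⁺ (All.tabulate (λ _ ())) ∷ Unique.map⁺ (λ { refl → refl }) (unique D i)

    apex-covers-vertex : ∀ x → ∃ λ i → x ∈ apexBag i
    apex-covers-vertex nothing = i₀ , here refl
    apex-covers-vertex (just x) with covers-vertex D x
    ... | i , x∈X = i , just∈apexBag x∈X

    apex-covers-edge : ∀ x y → Adj′ x y → ∃ λ i → x ∈ apexBag i × y ∈ apexBag i
    apex-covers-edge nothing y _ = let i , y∈ = apex-covers-vertex y in i , here refl , y∈
    apex-covers-edge (just x) nothing _ = let i , x∈ = apex-covers-vertex (just x) in i , x∈ , here refl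
    apex-covers-edge (just x) (just y) xy with covers-edge D x y (restrict x y xy)
    ... | i , x∈X , y∈X = i , just∈apexBag x∈X , just∈apexBag y∈X

    apex-contiguous : ∀ x → Contiguous apexBag x
    apex-contiguous nothing = contiguous-everywhere apexBag (λ _ → here refl)
    apex-contiguous (just x) i j l i≤j j≤l x∈i x∈l =
      just∈apexBag (contiguous D x i j l i≤j j≤l (just∈apexBag⁻ x∈i) (just∈apexBag⁻ x∈l))

  withApex : PathDecomposition (Maybe V) Adj′
  withApex = record
    { m = m D ; bag = apexBag ; unique = apexBag-unique
    ; covers-vertex = apex-covers-vertex ; covers-edge = apex-covers-edge
    ; contiguous = apex-contiguous }

  withApex-width : ∀ {w} → WidthAtMost D w → WidthAtMost withApex (suc w)
  withApex-width width i rewrite length-map just (bag D i) = s≤s (width i)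

module PosDecomposition (G : Graph) (σ : Edge G → Bool) (D : PathDecomposition (Fin (n G)) (Adj G)) where

  private
    N M S : ℕ
    N = n G
    M = m D
    S = N * N * 2

  ends : Edge G → Fin N × Fin N
  ends (u , v , _) = u , v

  edgeBetween : Fin N → Fin N → Maybe (Edge G)
  edgeBetween u v with u Fin.<? v | T? (adj G u v)
  ... | yes u<v | yes uv = just (u , v , u<v , uv)
  ... | _       | _      = nothing

  edgeBetween-ends : ∀ e → uncurry edgeBetween (ends e) ≡ just e
  edgeBetween-ends (u , v , u<v , uv) with u Fin.<? v | T? (adj G u v)
  ... | yes u<v′ | yes uv′ =
    cong₂ (λ p a → just (u , v , p , a)) (Fin.<-irrelevant u<v′ u<v) (T-irrelevant uv′ uv)
  ... | yes _    | no ¬uv  = ⊥-elim (¬uv uv)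
  ... | no u≮v   | _       = ⊥-elim (u≮v u<v)

  edgeBetween-just : ∀ u v {e} → edgeBetween u v ≡ just e → ends e ≡ (u , v)
  edgeBetween-just u v eq with u Fin.<? v | T? (adj G u v)
  edgeBetween-just u v refl | yes _ | yes _ = refl
  edgeBetween-just u v ()   | yes _ | no _
  edgeBetween-just u v ()   | no _  | _

  edgeBag : Edge G → Fin (suc M)
  edgeBag (u , v , _ , uv) = suc (proj₁ (covers-edge D u v uv))

  el : Fin 2 → Edge G → PosEl G
  el zero       = e₁
  el (suc zero) = e₂

  el-injective : ∀ {s s′ e e′} → el s e ≡ el s′ e′ → (s , e) ≡ (s′ , e′)
  el-injective {zero}     {zero}     refl = refl
  el-injective {suc zero} {suc zero} refl = refl
  el-injective {zero}     {suc zero} ()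
  el-injective {suc zero} {zero}     ()

  -- D with an empty bag in front, so that a bag exists even when D has none.
  X : Fin (suc M) → List (Fin N)
  X zero    = []
  X (suc i) = bag D i

  X-contiguous : ∀ v → Contiguous X v
  X-contiguous v zero _ _ _ _ () _
  X-contiguous v (suc i) (suc j) (suc l) (s≤s i≤j) (s≤s j≤l) = contiguous D v i j l i≤j j≤l

  X-unique : ∀ q → Unique (X q)
  X-unique zero    = []
  X-unique (suc i) = unique D i

  ends∈edgeBag : ∀ e → proj₁ (ends e) ∈ X (edgeBag e) × proj₂ (ends e) ∈ X (edgeBag e)
  ends∈edgeBag (u , v , _ , uv) = proj₂ (covers-edge D u v uv)

  encode : (Fin N × Fin N) × Fin 2 → Fin S
  encode (uv , s) = combine (uncurry combine uv) s

  decode : Fin S → (Fin N × Fin N) × Fin 2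
  decode c = map₁ (remQuot N) (remQuot {N * N} 2 c)

  encode-decode : ∀ c → encode (decode c) ≡ c
  encode-decode c =
    trans (cong (λ uv → combine uv (remainder {N * N} 2 c)) (Fin.combine-remQuot {N} N (quotient 2 c)))
          (Fin.combine-remQuot {N * N} 2 c)

  decode-encode : ∀ uv s → decode (encode (uv , s)) ≡ (uv , s)
  decode-encode (u , v) s = begin
    map₁ (remQuot N) (remQuot 2 (combine (combine u v) s))
      ≡⟨ cong (map₁ (remQuot N)) (Fin.remQuot-combine (combine u v) s) ⟩
    (remQuot N (combine u v) , s)
      ≡⟨ cong (_, s) (Fin.remQuot-combine u v) ⟩
    ((u , v) , s)
      ∎
    where open ≡-Reasoning

  slotOf : Fin 2 → Edge G → Fin (suc S)
  slotOf s e = suc (encode (ends e , s))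

  copyAt : (Fin N × Fin N) × Fin 2 → Maybe (Fin 2 × Edge G)
  copyAt (uv , s) with uncurry edgeBetween uv
  ... | just e  = just (s , e)
  ... | nothing = nothing

  copyAt-ends : ∀ s e → copyAt (ends e , s) ≡ just (s , e)
  copyAt-ends s e rewrite edgeBetween-ends e = refl

  copyAt-just : ∀ uv s {s′ e} → copyAt (uv , s) ≡ just (s′ , e) → (uv , s) ≡ (ends e , s′)
  copyAt-just (u , v) s eq with edgeBetween u v in between
  copyAt-just (u , v) s refl | just e = cong (_, s) (sym (edgeBetween-just u v between))

  slotCopy : Fin (suc S) → Maybe (Fin 2 × Edge G)
  slotCopy zero    = nothing
  slotCopy (suc c) = copyAt (decode c)

  slotCopy-slotOf : ∀ s e → slotCopy (slotOf s e) ≡ just (s , e)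
  slotCopy-slotOf s e = trans (cong copyAt (decode-encode (ends e) s)) (copyAt-ends s e)

  slotCopy-just : ∀ c {s e} → slotCopy c ≡ just (s , e) → c ≡ slotOf s e
  slotCopy-just (suc c) eq = cong suc (trans (sym (encode-decode c)) (cong encode (copyAt-just _ _ eq)))

  placed : Fin (suc M) → Maybe (Fin 2 × Edge G) → List (PosEl G)
  placed q nothing = []
  placed q (just (s , e)) with q Fin.≟ edgeBag e
  ... | yes _ = [ el s e ]
  ... | no _  = []

  ∈-placed⁻ : ∀ {x} q c → x ∈ placed q c →
              ∃ λ s → ∃ λ e → c ≡ just (s , e) × q ≡ edgeBag e × x ≡ el s e
  ∈-placed⁻ q (just (s , e)) x∈ with q Fin.≟ edgeBag e
  ∈-placed⁻ q (just (s , e)) (here refl) | yes q≡ = s , e , refl , q≡ , refl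

  el∈placed : ∀ s e → el s e ∈ placed (edgeBag e) (just (s , e))
  el∈placed s e with edgeBag e Fin.≟ edgeBag e
  ... | yes _ = here refl
  ... | no q≢q = ⊥-elim (q≢q refl)

  length-placed : ∀ q c → length (placed q c) ≤ 1
  length-placed q nothing = z≤n
  length-placed q (just (s , e)) with q Fin.≟ edgeBag e
  ... | yes _ = s≤s z≤n
  ... | no _  = z≤n

  placed-unique : ∀ q c → Unique (placed q c)
  placed-unique q nothing = []
  placed-unique q (just (s , e)) with q Fin.≟ edgeBag e
  ... | yes _ = All.[] ∷ []
  ... | no _  = []

  consts : List (PosEl G)
  consts = ⊤₁ ∷ ⊤₂ ∷ ∞a ∷ ∞b ∷ []

  copies : Fin N → List (PosEl G)
  copies v = vtx v ∷ va v ∷ vb v ∷ []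

  base : List (Fin N) → List (PosEl G)
  base = concatMap copies

  -- Bag q of X is repeated once per slot c; slot 0 holds no edge copy and slot
  -- 1 + encode (uv , s) holds el s e if uv is an edge e with edgeBag e ≡ q.
  bagAt : Fin (suc M) → Fin (suc S) → List (PosEl G)
  bagAt q c = consts ++ (base (X q) ++ placed q (slotCopy c))

  data Part : Set where
    constant vertexCopy edgeCopy : Part

  part : PosEl G → Part
  part (vtx _) = vertexCopy
  part (va _)  = vertexCopy
  part (vb _)  = vertexCopy
  part (e₁ _)  = edgeCopy
  part (e₂ _)  = edgeCopy
  part ⊤₁      = constant
  part ⊤₂      = constant
  part ∞a      = constant
  part ∞b      = constant

  part-consts : ∀ {x} → x ∈ consts → part x ≡ constant
  part-consts (here refl)                         = refl
  part-consts (there (here refl))                 = refl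
  part-consts (there (there (here refl)))         = refl
  part-consts (there (there (there (here refl)))) = refl

  part-copies : ∀ {x v} → x ∈ copies v → part x ≡ vertexCopy
  part-copies (here refl)                 = refl
  part-copies (there (here refl))         = refl
  part-copies (there (there (here refl))) = refl

  part-el : ∀ s e → part (el s e) ≡ edgeCopy
  part-el zero       e = refl
  part-el (suc zero) e = refl

  ∈-base⁻ : ∀ {x Y} → x ∈ base Y → ∃ λ w → w ∈ Y × x ∈ copies w
  ∈-base⁻ {Y = Y} x∈ = find (∈-concatMap⁻ copies {xs = Y} x∈)

  part-base : ∀ {x Y} → x ∈ base Y → part x ≡ vertexCopy
  part-base {Y = Y} x∈ = let _ , _ , x∈copies = ∈-base⁻ {Y = Y} x∈ in part-copies x∈copies

  part-placed : ∀ {x} q c → x ∈ placed q c → part x ≡ edgeCopy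
  part-placed q c x∈ with ∈-placed⁻ q c x∈
  ... | s , e , _ , _ , refl = part-el s e

  owner : PosEl G → Maybe (Fin N)
  owner (vtx v) = just v
  owner (va v)  = just v
  owner (vb v)  = just v
  owner _       = nothing

  owner-copies : ∀ {x v} → x ∈ copies v → owner x ≡ just v
  owner-copies (here refl)                 = refl
  owner-copies (there (here refl))         = refl
  owner-copies (there (there (here refl))) = refl

  copies-disjoint : ∀ {x v w} → x ∈ copies v → x ∈ copies w → v ≡ w
  copies-disjoint x∈v x∈w = just-injective (trans (sym (owner-copies x∈v)) (owner-copies x∈w))

  vtx∈copies : ∀ {v} → vtx v ∈ copies v
  vtx∈copies = here refl

  va∈copies : ∀ {v} → va v ∈ copies v
  va∈copies = there (here refl)

  vb∈copies : ∀ {v} → vb v ∈ copies v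
  vb∈copies = there (there (here refl))

  ⊤₁∈consts ⊤₂∈consts ∞a∈consts ∞b∈consts : _∈_ {A = PosEl G} _ consts
  ⊤₁∈consts = here refl
  ⊤₂∈consts = there (here refl)
  ∞a∈consts = there (there (here refl))
  ∞b∈consts = there (there (there (here refl)))

  copies-unique : ∀ v → Unique (copies v)
  copies-unique v = ((λ ()) All.∷ (λ ()) All.∷ All.[]) ∷ ((λ ()) All.∷ All.[]) ∷ All.[] ∷ []

  consts-unique : Unique consts
  consts-unique = ((λ ()) All.∷ (λ ()) All.∷ (λ ()) All.∷ All.[])
                ∷ ((λ ()) All.∷ (λ ()) All.∷ All.[])
                ∷ ((λ ()) All.∷ All.[])
                ∷ All.[] ∷ []

  base-unique : ∀ {Y} → Unique Y → Unique (base Y)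
  base-unique Y! = Unique.concat⁺ (All.map⁺ (All.universal copies-unique _))
    (AllPairs.map⁺ (AllPairs.map (λ v≢w {_} (x∈v , x∈w) → v≢w (copies-disjoint x∈v x∈w)) Y!))

  part-≢ : ∀ {y a b} → part y ≡ a → a ≢ b → part y ≢ b
  part-≢ refl a≢b = a≢b

  part-nonconstant : ∀ {y} Y q c → y ∈ base Y ++ placed q c → part y ≢ constant
  part-nonconstant Y q c y∈ with ∈-++⁻ (base Y) y∈
  ... | inj₁ y∈base   = part-≢ (part-base {Y = Y} y∈base) λ ()
  ... | inj₂ y∈placed = part-≢ (part-placed q c y∈placed) λ ()

  bagAt-unique : ∀ q c → Unique (bagAt q c)
  bagAt-unique q c = Unique.++⁺ consts-unique
    (Unique.++⁺ (base-unique (X-unique q)) (placed-unique q (slotCopy c))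
      (disjoint-by part (part-base {Y = X q}) λ y∈ → part-≢ (part-placed q (slotCopy c) y∈) λ ()))
    (disjoint-by part part-consts (part-nonconstant (X q) q (slotCopy c)))

  length-base : ∀ Y → length (base Y) ≡ 3 * length Y
  length-base []      = refl
  length-base (_ ∷ Y) = trans (cong (3 +_) (length-base Y)) (sym (ℕ.*-suc 3 (length Y)))

  X-width : ∀ {k} → WidthAtMost D k → ∀ q → length (X q) ≤ suc k
  X-width width zero    = z≤n
  X-width width (suc i) = width i

  bagAt-width : ∀ {k} → WidthAtMost D k → ∀ q c → length (bagAt q c) ≤ suc (3 * k + 7)
  bagAt-width {k} width q c = begin
    4 + length (base (X q) ++ edges)
      ≡⟨ cong (4 +_) (length-++ (base (X q))) ⟩
    4 + (length (base (X q)) + length edges)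
      ≡⟨ cong (λ b → 4 + (b + length edges)) (length-base (X q)) ⟩
    4 + (3 * length (X q) + length edges)
      ≤⟨ ℕ.+-monoʳ-≤ 4 (ℕ.+-mono-≤ (ℕ.*-monoʳ-≤ 3 (X-width width q)) (length-placed q (slotCopy c))) ⟩
    4 + (3 * suc k + 1)
      ≡⟨ solve 1 (λ k → con 4 :+ (con 3 :* (con 1 :+ k) :+ con 1) := con 1 :+ (con 3 :* k :+ con 7)) refl k ⟩
    suc (3 * k + 7)
      ∎
    where
    open ℕ.≤-Reasoning
    open +-*-Solver
    edges = placed q (slotCopy c)

  const∈bagAt : ∀ {x} q c → x ∈ consts → x ∈ bagAt q c
  const∈bagAt q c = ∈-++⁺ˡ

  copy∈bagAt : ∀ {x v} q c → x ∈ copies v → v ∈ X q → x ∈ bagAt q c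
  copy∈bagAt q c x∈v v∈X = ∈-++⁺ʳ consts (∈-++⁺ˡ (∈-concatMap⁺ copies (lose v∈X x∈v)))

  el∈bagAt : ∀ s e → el s e ∈ bagAt (edgeBag e) (slotOf s e)
  el∈bagAt s e = ∈-++⁺ʳ consts (∈-++⁺ʳ (base (X (edgeBag e)))
    (subst (λ copy → el s e ∈ placed (edgeBag e) copy) (sym (slotCopy-slotOf s e)) (el∈placed s e)))

  copy∈bagAt⁻ : ∀ {x v} q c → x ∈ copies v → x ∈ bagAt q c → v ∈ X q
  copy∈bagAt⁻ q c x∈v x∈bag with ∈-++⁻ consts x∈bag
  ... | inj₁ x∈consts = ⊥-elim (part-≢ (part-copies x∈v) (λ ()) (part-consts x∈consts))
  copy∈bagAt⁻ q c x∈v x∈bag | inj₂ x∈rest with ∈-++⁻ (base (X q)) x∈rest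
  ... | inj₁ x∈base =
    let w , w∈X , x∈w = ∈-base⁻ {Y = X q} x∈base in subst (_∈ X q) (copies-disjoint x∈w x∈v) w∈X
  ... | inj₂ x∈placed = ⊥-elim (part-≢ (part-copies x∈v) (λ ()) (part-placed q (slotCopy c) x∈placed))

  el∈bagAt⁻ : ∀ {s e} q c → el s e ∈ bagAt q c → (q , c) ≡ (edgeBag e , slotOf s e)
  el∈bagAt⁻ {s} {e} q c el∈bag with ∈-++⁻ consts el∈bag
  ... | inj₁ el∈consts = ⊥-elim (part-≢ (part-el s e) (λ ()) (part-consts el∈consts))
  el∈bagAt⁻ {s} {e} q c el∈bag | inj₂ el∈rest with ∈-++⁻ (base (X q)) el∈rest
  ... | inj₁ el∈base = ⊥-elim (part-≢ (part-el s e) (λ ()) (part-base {Y = X q} el∈base))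
  el∈bagAt⁻ {s} {e} q c el∈bag | inj₂ el∈rest | inj₂ el∈placed
    with _ , _ , copy≡ , q≡ , el≡ ← ∈-placed⁻ q (slotCopy c) el∈placed
    with refl ← el-injective el≡
    = cong₂ _,_ q≡ (slotCopy-just c copy≡)

  split : Fin (suc M * suc S) → Fin (suc M) × Fin (suc S)
  split = remQuot (suc S)

  posBag : Fin (suc M * suc S) → List (PosEl G)
  posBag t = uncurry bagAt (split t)

  ∈-posBag : ∀ {x} q c → x ∈ bagAt q c → x ∈ posBag (combine q c)
  ∈-posBag q c = subst (λ qc → _ ∈ uncurry bagAt qc) (sym (Fin.remQuot-combine q c))

  const∈posBag : ∀ {x} → x ∈ consts → ∀ t → x ∈ posBag t
  const∈posBag x∈ t = const∈bagAt (proj₁ (split t)) (proj₂ (split t)) x∈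

  vertexBag : Fin N → Fin (suc M * suc S)
  vertexBag v = combine (suc (proj₁ (covers-vertex D v))) zero

  copy∈vertexBag : ∀ {x} v → x ∈ copies v → x ∈ posBag (vertexBag v)
  copy∈vertexBag v x∈v = ∈-posBag q zero (copy∈bagAt q zero x∈v (proj₂ (covers-vertex D v)))
    where q = suc (proj₁ (covers-vertex D v))

  edgeCopyBag : Fin 2 → Edge G → Fin (suc M * suc S)
  edgeCopyBag s e = combine (edgeBag e) (slotOf s e)

  el∈posBag : ∀ s e → el s e ∈ posBag (edgeCopyBag s e)
  el∈posBag s e = ∈-posBag (edgeBag e) (slotOf s e) (el∈bagAt s e)

  posBag-covers-vertex : ∀ x → ∃ λ t → x ∈ posBag t
  posBag-covers-vertex (vtx v) = vertexBag v , copy∈vertexBag v vtx∈copies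
  posBag-covers-vertex (va v)  = vertexBag v , copy∈vertexBag v va∈copies
  posBag-covers-vertex (vb v)  = vertexBag v , copy∈vertexBag v vb∈copies
  posBag-covers-vertex (e₁ e)  = edgeCopyBag zero e , el∈posBag zero e
  posBag-covers-vertex (e₂ e)  = edgeCopyBag (suc zero) e , el∈posBag (suc zero) e
  posBag-covers-vertex ⊤₁      = zero , const∈posBag ⊤₁∈consts zero
  posBag-covers-vertex ⊤₂      = zero , const∈posBag ⊤₂∈consts zero
  posBag-covers-vertex ∞a      = zero , const∈posBag ∞a∈consts zero
  posBag-covers-vertex ∞b      = zero , const∈posBag ∞b∈consts zero

  Together : PosEl G → PosEl G → Set
  Together x y = ∃ λ t → x ∈ posBag t × y ∈ posBag t

  together-const : ∀ {x c} → c ∈ consts → Together x c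
  together-const {x} c∈ = let t , x∈ = posBag-covers-vertex x in t , x∈ , const∈posBag c∈ t

  together-copies : ∀ {x y} v → x ∈ copies v → y ∈ copies v → Together x y
  together-copies v x∈v y∈v = vertexBag v , copy∈vertexBag v x∈v , copy∈vertexBag v y∈v

  together-ends : ∀ {x w} s e → x ∈ copies w → w ∈ X (edgeBag e) → Together x (el s e)
  together-ends s e x∈w w∈X =
    edgeCopyBag s e ,
    ∈-posBag (edgeBag e) (slotOf s e) (copy∈bagAt (edgeBag e) (slotOf s e) x∈w w∈X) ,
    el∈posBag s e

  together-source : ∀ {x} s e → x ∈ copies (proj₁ (ends e)) → Together x (el s e)
  together-source s e x∈ = together-ends s e x∈ (proj₁ (ends∈edgeBag e))

  together-target : ∀ {x} s e → x ∈ copies (proj₂ (ends e)) → Together x (el s e)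
  together-target s e x∈ = together-ends s e x∈ (proj₂ (ends∈edgeBag e))

  gen-together : ∀ {x y} → Gen G σ x y → Together x y
  gen-together (v-va v)            = together-copies v vtx∈copies va∈copies
  gen-together (v-vb v)            = together-copies v vtx∈copies vb∈copies
  gen-together (va-∞a v)           = together-const ∞a∈consts
  gen-together (vb-∞b v)           = together-const ∞b∈consts
  gen-together (e₁-⊤₁ e)           = together-const ⊤₁∈consts
  gen-together (e₁-⊤₂ e)           = together-const ⊤₂∈consts
  gen-together (e₂-⊤₁ e)           = together-const ⊤₁∈consts
  gen-together (e₂-⊤₂ e)           = together-const ⊤₂∈consts
  gen-together (iso-va-⊤₁ v _)     = together-const ⊤₁∈consts
  gen-together (iso-va-⊤₂ v _)     = together-const ⊤₂∈consts
  gen-together (iso-vb-⊤₁ v _)     = together-const ⊤₁∈consts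
  gen-together (iso-vb-⊤₂ v _)     = together-const ⊤₂∈consts
  gen-together (t-ua-e₁ u v p a _) = together-source zero       (u , v , p , a) va∈copies
  gen-together (t-vb-e₁ u v p a _) = together-target zero       (u , v , p , a) vb∈copies
  gen-together (t-ub-e₂ u v p a _) = together-source (suc zero) (u , v , p , a) vb∈copies
  gen-together (t-va-e₂ u v p a _) = together-target (suc zero) (u , v , p , a) va∈copies
  gen-together (f-ua-e₂ u v p a _) = together-source (suc zero) (u , v , p , a) va∈copies
  gen-together (f-vb-e₂ u v p a _) = together-target (suc zero) (u , v , p , a) vb∈copies
  gen-together (f-ub-e₁ u v p a _) = together-source zero       (u , v , p , a) vb∈copies
  gen-together (f-va-e₁ u v p a _) = together-target zero       (u , v , p , a) va∈copies

  gen-irreflexive : ∀ {x} → ¬ Gen G σ x x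
  gen-irreflexive ()

  posBag-covers-edge : ∀ x y → CoverAdj (PosOrder G σ) x y → Together x y
  posBag-covers-edge x y (inj₁ x⋖y) = gen-together (covers⇒step gen-irreflexive x⋖y)
  posBag-covers-edge x y (inj₂ y⋖x) = map₂ swap (gen-together (covers⇒step gen-irreflexive y⋖x))

  copy-contiguous : ∀ {x v} → x ∈ copies v → Contiguous posBag x
  copy-contiguous {v = v} x∈v = contiguous-pullback posBag (proj₁ ∘ split) (quotient-mono (suc S))
    (λ t → copy∈bagAt⁻ (proj₁ (split t)) (proj₂ (split t)) x∈v)
    (λ t → copy∈bagAt (proj₁ (split t)) (proj₂ (split t)) x∈v) (X-contiguous v)

  el-contiguous : ∀ s e → Contiguous posBag (el s e)
  el-contiguous s e = contiguous-single posBag (edgeCopyBag s e)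
    λ t el∈ → trans (sym (Fin.combine-remQuot {suc M} (suc S) t))
                    (cong (uncurry combine) (el∈bagAt⁻ (proj₁ (split t)) (proj₂ (split t)) el∈))

  const-contiguous : ∀ {x} → x ∈ consts → Contiguous posBag x
  const-contiguous x∈ = contiguous-everywhere posBag (const∈posBag x∈)

  posBag-contiguous : ∀ x → Contiguous posBag x
  posBag-contiguous (vtx v) = copy-contiguous vtx∈copies
  posBag-contiguous (va v)  = copy-contiguous va∈copies
  posBag-contiguous (vb v)  = copy-contiguous vb∈copies
  posBag-contiguous (e₁ e)  = el-contiguous zero e
  posBag-contiguous (e₂ e)  = el-contiguous (suc zero) e
  posBag-contiguous ⊤₁      = const-contiguous ⊤₁∈consts
  posBag-contiguous ⊤₂      = const-contiguous ⊤₂∈consts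
  posBag-contiguous ∞a      = const-contiguous ∞a∈consts
  posBag-contiguous ∞b      = const-contiguous ∞b∈consts

  decomposition : PathDecomposition (PosEl G) (CoverAdj (PosOrder G σ))
  decomposition = record
    { m = suc M * suc S ; bag = posBag
    ; unique = λ t → bagAt-unique (proj₁ (split t)) (proj₂ (split t))
    ; covers-vertex = posBag-covers-vertex ; covers-edge = posBag-covers-edge
    ; contiguous = posBag-contiguous }

  decomposition-width : ∀ {k} → WidthAtMost D k → WidthAtMost decomposition (3 * k + 7)
  decomposition-width width t = bagAt-width width (proj₁ (split t)) (proj₂ (split t))

just-covers : ∀ {G σ x y} → Covers (PosBotOrder G σ) (just x) (just y) → Covers (PosOrder G σ) x y
just-covers (lift≤ x≤y , x≢y , between) =
  x≤y , (λ x≡y → x≢y (cong just x≡y)) ,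
  λ z x≤z z≤y → Sum.map just-injective just-injective (between (just z) (lift≤ x≤z) (lift≤ z≤y))

just-coverAdj : ∀ {G σ} x y → CoverAdj (PosBotOrder G σ) (just x) (just y) → CoverAdj (PosOrder G σ) x y
just-coverAdj x y = Sum.map just-covers just-covers

lemma11 : (G : Graph) (k : ℕ) → 1 ≤ k → HasPathwidth (Fin (n G)) (Adj G) k →
          (σ : Edge G → Bool) →
          PathwidthAtMost (PosEl G) (CoverAdj (PosOrder G σ)) (3 * k + 7)
          × PathwidthAtMost (Maybe (PosEl G)) (CoverAdj (PosBotOrder G σ)) (3 * k + 8)
lemma11 G k _ ((D , width) , _) σ =
    (decomposition , decomposition-width width)
  , subst (PathwidthAtMost (Maybe (PosEl G)) (CoverAdj (PosBotOrder G σ))) (sym (ℕ.+-suc (3 * k) 7))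
      (withApex decomposition zero {CoverAdj (PosBotOrder G σ)} just-coverAdj ,
       withApex-width decomposition zero {CoverAdj (PosBotOrder G σ)} just-coverAdj (decomposition-width width))
  where open PosDecomposition G σ D
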